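{- Let $G$ be a connected bipartite graph and let $Y$ be a Gyárfás decomposition of $G$. Let $B$ be a bag of $Y$ with level $i>1$ and let $G_B$ be the subgraph of $G$ induced by $B$ together with the union of all the bags that are descendants of $B$ at levels $i'\not\equiv i \pmod 2$. Then $\operatorname{bind}(G_B)<\operatorname{bind}(G)$.
   Context: For a bipartite graph $G$ (with fixed bipartition; induced subgraphs inherit it), the bipartite index $\operatorname{bind}(G)$ is the maximum $k$ such that $G$ contains vertices $a_1,\dots,a_k,b_1,\dots,b_k$ with all $a_i$ on one side, all $b_j$ on the other side, and for all $1\le i<j\le k$, $a_i$ adjacent to $b_j$ and $b_i$ not adjacent to $a_j$. A Gyárfás decomposition of a connected graph $G$ is a rooted tree $Y$ such that: (1) the nodes (bags) are pairwise disjoint non-empty subsets of $V(G)$ with union $V(G)$; (2) the root bag is a single vertex; (3) if $u\in B$, $u'\in B'$ are adjacent then one of $B,B'$ is an ancestor of the other (each node is its own ancestor); (4) for every bag $B$, the union of $B$ and its descendants induces a connected subgraph; (5) every non-root bag $B$ has a hook $h(B)$ in its parent bag adjacent to all vertices of $B$ and non-adjacent to all vertices in strict descendants of $B$. The level of a bag is the number of edges on the path in $Y$ to the root. -}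

module Defs where

open import Data.Nat using (ℕ; zero; suc; _<_; _%_)
open import Data.Fin using (Fin) renaming (_<_ to _<ᶠ_)
open import Data.Bool using (Bool; true; false; not)
open import Data.Product using (Σ; ∃; _×_; _,_)
open import Data.Sum using (_⊎_)
open import Data.Unit using (⊤)
open import Relation.Nullary using (¬_)
open import Relation.Binary.PropositionalEquality using (_≡_; _≢_)
open import Function.Definitions using (Injective)

record Graph (n : ℕ) : Set where
  field
    adj       : Fin n → Fin n → Bool
    adj-sym   : ∀ u v → adj u v ≡ adj v u
    adj-irref : ∀ v → adj v v ≡ false

open Graph public

record BipartiteGraph (n : ℕ) : Set where
  field
    graph     : Graph n
    side      : Fin n → Bool
    bipartite : ∀ u v → adj graph u v ≡ true → side u ≢ side v

open BipartiteGraph public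

VSet : ℕ → Set₁
VSet n = Fin n → Set

everything : ∀ {n} → VSet n
everything _ = ⊤

data WalkIn {n} (G : Graph n) (S : VSet n) : Fin n → Fin n → Set where
  here : ∀ {u} → S u → WalkIn G S u u
  step : ∀ {u w v} → S u → adj G u w ≡ true → WalkIn G S w v → WalkIn G S u v

ConnectedOn : ∀ {n} → Graph n → VSet n → Set
ConnectedOn G S = ∀ u v → S u → S v → WalkIn G S u v

Connected : ∀ {n} → Graph n → Set
Connected G = ConnectedOn G everything

-- Witness of bipartite index ≥ k in the induced subgraph G[S]
-- (bipartition inherited from G).
record BindWitness {n} (G : BipartiteGraph n) (S : VSet n) (k : ℕ) : Set where
  field
    a     : Fin k → Fin n
    b     : Fin k → Fin n
    a-inj : Injective _≡_ _≡_ a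
    b-inj : Injective _≡_ _≡_ b
    a∈S   : ∀ i → S (a i)
    b∈S   : ∀ i → S (b i)
    s     : Bool
    a-side : ∀ i → side G (a i) ≡ s
    b-side : ∀ i → side G (b i) ≡ not s
    a-b-adj    : ∀ i j → i <ᶠ j → adj (graph G) (a i) (b j) ≡ true
    b-a-nonadj : ∀ i j → i <ᶠ j → adj (graph G) (b i) (a j) ≡ false

IsBind : ∀ {n} → BipartiteGraph n → VSet n → ℕ → Set
IsBind G S m = BindWitness G S m × (∀ k → BindWitness G S k → k Data.Nat.≤ m)

iter : ∀ {A : Set} → (A → A) → ℕ → A → A
iter f zero    x = x
iter f (suc t) x = f (iter f t x)

record RootedTree (m : ℕ) : Set where
  field
    root        : Fin m
    parent      : Fin m → Fin m
    level       : Fin m → ℕ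
    level-root  : level root ≡ 0
    level-zero  : ∀ x → level x ≡ 0 → x ≡ root
    level-parent : ∀ x → x ≢ root → level x ≡ suc (level (parent x))

  -- A is an ancestor of D (each node is its own ancestor)
  Ancestor : Fin m → Fin m → Set
  Ancestor A D = ∃ λ t → iter parent t D ≡ A

  StrictAncestor : Fin m → Fin m → Set
  StrictAncestor A D = Ancestor A D × A ≢ D

open RootedTree public

-- Gyárfás decomposition of a (connected) graph G on Fin n, with m bags.
-- bag v is the bag containing vertex v (so bags are disjoint and cover V(G)).
record Gyarfas {n} (G : Graph n) : Set where
  field
    m        : ℕ
    tree     : RootedTree m
    bag      : Fin n → Fin m
    nonempty : ∀ x → ∃ λ v → bag v ≡ x
    root-single : ∀ u v → bag u ≡ root tree → bag v ≡ root tree → u ≡ v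
    edges-comparable : ∀ u v → adj G u v ≡ true →
      Ancestor tree (bag u) (bag v) ⊎ Ancestor tree (bag v) (bag u)
    down-connected : ∀ x → ConnectedOn G (λ v → Ancestor tree x (bag v))
    hook : ∀ x → x ≢ root tree → ∃ λ h →
      (bag h ≡ parent tree x)
      × (∀ v → bag v ≡ x → adj G h v ≡ true)
      × (∀ v → StrictAncestor tree x (bag v) → adj G h v ≡ false)

open Gyarfas public

GB : ∀ {n} {G : Graph n} → (Y : Gyarfas G) → Fin (m Y) → VSet n
GB Y B v = (bag Y v ≡ B)
  ⊎ (Ancestor (tree Y) B (bag Y v)
     × (level (tree Y) (bag Y v) % 2 ≢ level (tree Y) B % 2))

{-# OPTIONS --safe #-}
module Submission where

-- Sides of G alternate with levels of Y, since each hook is adjacent to its bag.  Hence a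
-- bipartite-index witness of G_B, oriented so that its b's lie on the side of B, has all its
-- b's in B.  Prepending the hook of B (adjacent to all of B) as a new a and the hook of the
-- parent of B (non-adjacent to everything strictly below the parent, in particular to G_B)
-- as a new b gives a longer witness in G; level > 1 guarantees that the parent has a hook.

open import Defs
open import Data.Nat using (ℕ; _<_)
open import Data.Fin using (Fin)

open import Data.Bool using (true; false; not; _≟_)
open import Data.Bool.Properties using (not-involutive; ¬-not; not-¬)
open import Data.Empty using (⊥-elim)
open import Data.Fin using (zero; suc; opposite) renaming (_<_ to _<ᶠ_)
open import Data.Fin.Properties using (opposite-prop; opposite-involutive; toℕ<n)
open import Data.Nat using (zero; suc; _%_; s≤s; z≤n)
open import Data.Nat.Properties
  using (suc-injective; 1+n≢n; m≢1+n+m; <-irrefl; ∸-monoʳ-<; ≤-pred; <-trans)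
open import Data.Product using (Σ; _,_; proj₁; proj₂)
open import Data.Sum using (inj₁; inj₂)
open import Data.Unit using (tt)
open import Data.Vec.Functional using (_∷_)
open import Function using (_∘_)
open import Function.Construct.Composition using (injective)
open import Relation.Nullary using (¬_; yes; no; contradiction)
open import Relation.Binary.PropositionalEquality

iter-suc : ∀ {A : Set} (f : A → A) t x → iter f (suc t) x ≡ iter f t (f x)
iter-suc f zero    x = refl
iter-suc f (suc t) x = cong f (iter-suc f t x)

iter-not-parity : ∀ m n {b} → iter not m b ≡ iter not n b → m % 2 ≡ n % 2
iter-not-parity (suc (suc m)) n     e = iter-not-parity m n (trans (sym (not-involutive _)) e)
iter-not-parity m (suc (suc n))     e = iter-not-parity m n (trans e (not-involutive _))
iter-not-parity zero       zero       _ = refl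
iter-not-parity (suc zero) (suc zero) _ = refl
iter-not-parity zero       (suc zero) e = ⊥-elim (not-¬ refl e)
iter-not-parity (suc zero) zero       e = ⊥-elim (not-¬ refl (sym e))

opposite-injective : ∀ {k} {i j : Fin k} → opposite i ≡ opposite j → i ≡ j
opposite-injective {i = i} {j} e =
  trans (sym (opposite-involutive i)) (trans (cong opposite e) (opposite-involutive j))

opposite-reverses-< : ∀ {k} {i j : Fin k} → i <ᶠ j → opposite j <ᶠ opposite i
opposite-reverses-< {k} {i} {j} i<j rewrite opposite-prop i | opposite-prop j =
  ∸-monoʳ-< {m = k} (s≤s i<j) (toℕ<n j)

cons-injective : ∀ {A : Set} {k} {x : A} {f : Fin k → A} →
  (∀ i → f i ≢ x) → (∀ {i j} → f i ≡ f j → i ≡ j) →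
  ∀ {i j} → (x ∷ f) i ≡ (x ∷ f) j → i ≡ j
cons-injective x∉f f-inj {zero}  {zero}  _ = refl
cons-injective x∉f f-inj {zero}  {suc j} e = ⊥-elim (x∉f j (sym e))
cons-injective x∉f f-inj {suc i} {zero}  e = ⊥-elim (x∉f i e)
cons-injective x∉f f-inj {suc i} {suc j} e = cong suc (f-inj e)

module _ {n} {G : BipartiteGraph n} {S : VSet n} where
  open BindWitness

  reverse : ∀ {k} → BindWitness G S k → BindWitness G S k
  reverse W = record
    { a = b W ∘ opposite
    ; b = a W ∘ opposite
    ; a-inj = injective _≡_ _≡_ _≡_ opposite-injective (b-inj W)
    ; b-inj = injective _≡_ _≡_ _≡_ opposite-injective (a-inj W)
    ; a∈S = b∈S W ∘ opposite
    ; b∈S = a∈S W ∘ opposite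
    ; s = not (s W)
    ; a-side = b-side W ∘ opposite
    ; b-side = λ i → trans (a-side W (opposite i)) (sym (not-involutive (s W)))
    ; a-b-adj = λ i j i<j →
        trans (adj-sym (graph G) _ _) (a-b-adj W _ _ (opposite-reverses-< i<j))
    ; b-a-nonadj = λ i j i<j →
        trans (adj-sym (graph G) _ _) (b-a-nonadj W _ _ (opposite-reverses-< i<j))
    }

  orient : ∀ {k} → BindWitness G S k → ∀ t → Σ (BindWitness G S k) λ W → s W ≡ t
  orient W t with s W ≟ t
  ... | yes sW≡t = W , sW≡t
  ... | no  sW≢t = reverse W , trans (cong not (¬-not sW≢t)) (not-involutive t)

  prepend : ∀ {k} (W : BindWitness G S k) (x y : Fin n) →
    (∀ i → a W i ≢ x) → (∀ i → b W i ≢ y) →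
    side G x ≡ s W → side G y ≡ not (s W) →
    (∀ j → adj (graph G) x (b W j) ≡ true) →
    (∀ j → adj (graph G) y (a W j) ≡ false) →
    BindWitness G everything (suc k)
  prepend W x y x∉a y∉b x-side y-side x-adj y-nonadj = record
    { a = x ∷ a W
    ; b = y ∷ b W
    ; a-inj = cons-injective x∉a (a-inj W)
    ; b-inj = cons-injective y∉b (b-inj W)
    ; a∈S = λ _ → tt
    ; b∈S = λ _ → tt
    ; s = s W
    ; a-side = λ { zero → x-side ; (suc i) → a-side W i }
    ; b-side = λ { zero → y-side ; (suc i) → b-side W i }
    ; a-b-adj = λ { zero    (suc j) _         → x-adj j
                  ; (suc i) (suc j) (s≤s i<j) → a-b-adj W i j i<j }
    ; b-a-nonadj = λ { zero    (suc j) _         → y-nonadj j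
                     ; (suc i) (suc j) (s≤s i<j) → b-a-nonadj W i j i<j }
    }

module Decomposition {n} (G : BipartiteGraph n) (Y : Gyarfas (graph G)) where
  private
    T = tree Y
    E = graph G

  module Hook {X} (X≢r : X ≢ root T) where
    vertex : Fin n
    vertex = proj₁ (hook Y X X≢r)

    in-parent : bag Y vertex ≡ parent T X
    in-parent = proj₁ (proj₂ (hook Y X X≢r))

    adjacent : ∀ v → bag Y v ≡ X → adj E vertex v ≡ true
    adjacent = proj₁ (proj₂ (proj₂ (hook Y X X≢r)))

    nonadjacent : ∀ v → StrictAncestor T X (bag Y v) → adj E vertex v ≡ false
    nonadjacent = proj₂ (proj₂ (proj₂ (hook Y X X≢r)))

    side-opposite : ∀ {v} → bag Y v ≡ X → side G vertex ≡ not (side G v)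
    side-opposite v∈X = ¬-not (bipartite G vertex _ (adjacent _ v∈X))

    level-below : level T X ≡ suc (level T (bag Y vertex))
    level-below = trans (level-parent T X X≢r) (cong (suc ∘ level T) (sym in-parent))

  positive-level⇒≢root : ∀ {X} → 0 < level T X → X ≢ root T
  positive-level⇒≢root 0<l refl = <-irrefl (sym (level-root T)) 0<l

  level>1⇒parent≢root : ∀ {X} (X≢r : X ≢ root T) → 1 < level T X → parent T X ≢ root T
  level>1⇒parent≢root {X} X≢r 1<l =
    positive-level⇒≢root (≤-pred (subst (1 <_) (level-parent T X X≢r) 1<l))

  ≢parent : ∀ {X} → X ≢ root T → X ≢ parent T X
  ≢parent {X} X≢r X≡P =
    1+n≢n (trans (sym (level-parent T X X≢r)) (cong (level T) X≡P))

  ≢grandparent : ∀ {X} → X ≢ root T → parent T X ≢ root T →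
    X ≢ parent T (parent T X)
  ≢grandparent {X} X≢r P≢r X≡GP = m≢1+n+m _ {1} (begin
    level T (parent T (parent T X))             ≡⟨ cong (level T) X≡GP ⟨
    level T X                                   ≡⟨ level-parent T X X≢r ⟩
    suc (level T (parent T X))                  ≡⟨ cong suc (level-parent T _ P≢r) ⟩
    suc (suc (level T (parent T (parent T X)))) ∎)
    where open ≡-Reasoning

  ancestor-parent : ∀ {A D} → Ancestor T A D → Ancestor T (parent T A) D
  ancestor-parent (t , e) = suc t , cong (parent T) e

  side-by-level : ∀ v →
    side G v ≡ iter not (level T (bag Y v)) (side G (proj₁ (nonempty Y (root T))))
  side-by-level v = go (level T (bag Y v)) v refl
    where
    r = proj₁ (nonempty Y (root T))
    go : ∀ L v → level T (bag Y v) ≡ L → side G v ≡ iter not L (side G r)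
    go zero    v l≡0 =
      cong (side G) (root-single Y v r (level-zero T _ l≡0) (proj₂ (nonempty Y (root T))))
    go (suc L) v l≡1+L = begin
      side G v                    ≡⟨ not-involutive (side G v) ⟨
      not (not (side G v))        ≡⟨ cong not (side-opposite refl) ⟨
      not (side G vertex)
        ≡⟨ cong not (go L vertex (suc-injective (trans (sym level-below) l≡1+L))) ⟩
      iter not (suc L) (side G r) ∎
      where
      open ≡-Reasoning
      open Hook {bag Y v} (positive-level⇒≢root (subst (0 <_) (sym l≡1+L) (s≤s z≤n)))

  same-side⇒same-level-parity : ∀ u v → side G u ≡ side G v →
    level T (bag Y u) % 2 ≡ level T (bag Y v) % 2
  same-side⇒same-level-parity u v e =
    iter-not-parity (level T (bag Y u)) (level T (bag Y v))
      (trans (sym (side-by-level u)) (trans e (side-by-level v)))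

  -- Levels cannot rule this out, as the parent of the root is unconstrained.  Instead: the hook
  -- of parent X lies in the grandparent and is adjacent to the hook of X, so it is not a strict
  -- descendant of X.
  ¬ancestor-of-grandparent : ∀ {X} (X≢r : X ≢ root T) (P≢r : parent T X ≢ root T) →
    ¬ Ancestor T X (parent T (parent T X))
  ¬ancestor-of-grandparent {X} X≢r P≢r X≤GP = contradiction
    (trans (sym (hP.adjacent hX.vertex hX.in-parent))
      (trans (adj-sym E _ _) (hX.nonadjacent hP.vertex (X≤hP , X≢hP))))
    λ ()
    where
    module hX = Hook X≢r
    module hP = Hook P≢r
    X≤hP : Ancestor T X (bag Y hP.vertex)
    X≤hP = subst (Ancestor T X) (sym hP.in-parent) X≤GP
    X≢hP : X ≢ bag Y hP.vertex
    X≢hP e = ≢grandparent X≢r P≢r (trans e hP.in-parent)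

  ¬ancestor-of-parent : ∀ {X} (X≢r : X ≢ root T) (P≢r : parent T X ≢ root T) →
    ¬ Ancestor T X (parent T X)
  ¬ancestor-of-parent X≢r P≢r (zero  , e) = ≢parent X≢r (sym e)
  ¬ancestor-of-parent X≢r P≢r (suc t , e) =
    ¬ancestor-of-grandparent X≢r P≢r (t , trans (sym (iter-suc (parent T) t _)) e)

  GB⇒descendant : ∀ {B v} → GB Y B v → Ancestor T B (bag Y v)
  GB⇒descendant (inj₁ v∈B)       = 0 , v∈B
  GB⇒descendant (inj₂ (B≤v , _)) = B≤v

  GB-same-side⇒in-B : ∀ {B u v} → bag Y u ≡ B → GB Y B v → side G v ≡ side G u → bag Y v ≡ B
  GB-same-side⇒in-B u∈B (inj₁ v∈B)            _ = v∈B
  GB-same-side⇒in-B u∈B (inj₂ (_ , parity≢)) e = ⊥-elim (parity≢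
    (trans (same-side⇒same-level-parity _ _ e) (cong (λ X → level T X % 2) u∈B)))

  GB-witness-extends : ∀ {B k} → 1 < level T B →
    BindWitness G (GB Y B) k → BindWitness G everything (suc k)
  GB-witness-extends {B} 1<l W₀ =
    prepend W hB.vertex hP.vertex hB∉a hP∉b (sym s≡hB) hP-side hB-adj hP-nonadj
    where
    open BindWitness
    B≢r = positive-level⇒≢root (<-trans (s≤s z≤n) 1<l)
    P≢r = level>1⇒parent≢root B≢r 1<l
    module hB = Hook B≢r
    module hP = Hook P≢r

    W = proj₁ (orient W₀ (side G hB.vertex))
    s≡hB : s W ≡ side G hB.vertex
    s≡hB = proj₂ (orient W₀ (side G hB.vertex))

    GB∌parent : ∀ {v} → GB Y B v → bag Y v ≢ parent T B
    GB∌parent v∈GB e = ¬ancestor-of-parent B≢r P≢r (subst (Ancestor T B) e (GB⇒descendant v∈GB))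

    GB∌grandparent : ∀ {v} → GB Y B v → bag Y v ≢ parent T (parent T B)
    GB∌grandparent v∈GB e =
      ¬ancestor-of-grandparent B≢r P≢r (subst (Ancestor T B) e (GB⇒descendant v∈GB))

    hB∉a : ∀ i → a W i ≢ hB.vertex
    hB∉a i e = GB∌parent (a∈S W i) (trans (cong (bag Y) e) hB.in-parent)

    hP∉b : ∀ i → b W i ≢ hP.vertex
    hP∉b i e = GB∌grandparent (b∈S W i) (trans (cong (bag Y) e) hP.in-parent)

    hP-side : side G hP.vertex ≡ not (s W)
    hP-side = trans (hP.side-opposite hB.in-parent) (cong not (sym s≡hB))

    u = proj₁ (nonempty Y B)
    u∈B = proj₂ (nonempty Y B)

    hB-adj : ∀ j → adj E hB.vertex (b W j) ≡ true
    hB-adj j = hB.adjacent _ (GB-same-side⇒in-B u∈B (b∈S W j) (begin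
      side G (b W j)               ≡⟨ b-side W j ⟩
      not (s W)                    ≡⟨ cong not s≡hB ⟩
      not (side G hB.vertex)       ≡⟨ cong not (hB.side-opposite u∈B) ⟩
      not (not (side G u))         ≡⟨ not-involutive _ ⟩
      side G u                     ∎))
      where open ≡-Reasoning

    hP-nonadj : ∀ j → adj E hP.vertex (a W j) ≡ false
    hP-nonadj j = hP.nonadjacent _
      (ancestor-parent (GB⇒descendant (a∈S W j)) , GB∌parent (a∈S W j) ∘ sym)

lemma5p9 : ∀ {n} (G : BipartiteGraph n) → Connected (graph G) →
    (Y : Gyarfas (graph G)) → (B : Fin (m Y)) → 1 < level (tree Y) B →
    ∀ p q → IsBind G (GB Y B) p → IsBind G everything q → p < q
lemma5p9 G _ Y B 1<l p q (W , _) (_ , q-maximal) =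
  q-maximal (suc p) (GB-witness-extends 1<l W)
  where open Decomposition G Y
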